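{- There exists a $(\mathbb Z_2^3\times\mathbb Z_{12},\{2^{15},3^1\},3,1)$-difference family.
   Context: Let $(G,+)$ be a finite abelian group. A partial spread of $G$ is a family $\Sigma$ of subgroups of $G$ whose members pairwise intersect trivially; it has type $\{n_1^{f_1},\dots,n_t^{f_t}\}$ if it consists of exactly $f_i$ subgroups of order $n_i$ for each $i$ (and no others). For a triple $T=\{a,b,c\}$ of three distinct elements of $G$, $\Delta T$ is the multiset $\{\pm(a-b),\pm(a-c),\pm(b-c)\}$, and for a set $\mathcal T$ of triples, $\Delta\mathcal T$ is the multiset union of the $\Delta T$. For a partial spread $\Sigma$, a $(G,\Sigma,3,1)$-difference family is a set $\mathcal T$ of triples of $G$ with $\Delta\mathcal T=G\setminus\bigcup_{S\in\Sigma}S$ as multisets (each element outside the union occurs exactly once, elements of the union do not occur). A $(G,\tau,3,1)$-difference family is a $(G,\Sigma,3,1)$-difference family for some partial spread $\Sigma$ of $G$ of type $\tau$. -}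

module Defs where

open import Data.Nat using (ℕ; zero; suc; _+_; _∸_; NonZero)
open import Data.Nat.DivMod using (_mod_)
open import Data.Fin using (Fin; toℕ) renaming (_≟_ to _≟F_)
open import Data.Bool using (Bool; true; false; T; _∨_; not)
open import Data.Product using (_×_; _,_; Σ)
open import Data.Product.Properties using (≡-dec)
open import Data.List using (List; []; _∷_; length; filter; filterᵇ; allFin; cartesianProduct; concatMap; map)
open import Data.Vec using (Vec; lookup)
open import Relation.Binary.PropositionalEquality using (_≡_)
open import Relation.Binary.Definitions using (DecidableEquality)
open import Relation.Nullary using (¬_; does)

addℤ : {n : ℕ} .{{_ : NonZero n}} → Fin n → Fin n → Fin n
addℤ {n} a b = (toℕ a + toℕ b) mod n

negℤ : {n : ℕ} .{{_ : NonZero n}} → Fin n → Fin n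
negℤ {n} a = (n ∸ toℕ a) mod n

zeroℤ : {n : ℕ} .{{_ : NonZero n}} → Fin n
zeroℤ {n} = 0 mod n

G : Set
G = Fin 2 × Fin 2 × Fin 2 × Fin 12

infixl 6 _+G_ _-G_

_+G_ : G → G → G
(a₁ , a₂ , a₃ , a₄) +G (b₁ , b₂ , b₃ , b₄) =
  (addℤ a₁ b₁ , addℤ a₂ b₂ , addℤ a₃ b₃ , addℤ a₄ b₄)

-G_ : G → G
-G (a₁ , a₂ , a₃ , a₄) = (negℤ a₁ , negℤ a₂ , negℤ a₃ , negℤ a₄)

_-G_ : G → G → G
a -G b = a +G (-G b)

0G : G
0G = (zeroℤ , zeroℤ , zeroℤ , zeroℤ)

_≟G_ : DecidableEquality G
_≟G_ = ≡-dec _≟F_ (≡-dec _≟F_ (≡-dec _≟F_ _≟F_))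

elemsG : List G
elemsG = cartesianProduct (allFin 2)
           (cartesianProduct (allFin 2) (cartesianProduct (allFin 2) (allFin 12)))

IsSubgroup : (G → Bool) → Set
IsSubgroup S = T (S 0G) × (∀ x y → T (S x) → T (S y) → T (S (x -G y)))

record Subgroup : Set where
  field
    mem        : G → Bool
    isSubgroup : IsSubgroup mem
open Subgroup public

order : Subgroup → ℕ
order H = length (filterᵇ (mem H) elemsG)

TrivialIntersection : Subgroup → Subgroup → Set
TrivialIntersection H K = ∀ g → T (mem H g) → T (mem K g) → g ≡ 0G

record Spread-2^15-3^1 : Set where
  field
    A       : Fin 15 → Subgroup
    B       : Subgroup
    orderA  : ∀ i → order (A i) ≡ 2
    orderB  : order B ≡ 3
    trivAA  : ∀ i j → ¬ (i ≡ j) → TrivialIntersection (A i) (A j)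
    trivAB  : ∀ i → TrivialIntersection (A i) B
open Spread-2^15-3^1 public

inUnion : Spread-2^15-3^1 → G → Bool
inUnion Σ g = mem (B Σ) g ∨ anyA (allFin 15)
  where
    anyA : List (Fin 15) → Bool
    anyA []       = false
    anyA (i ∷ is) = mem (A Σ i) g ∨ anyA is

record Triple : Set where
  constructor triple
  field
    a b c : G
    a≢b   : ¬ (a ≡ b)
    a≢c   : ¬ (a ≡ c)
    b≢c   : ¬ (b ≡ c)
open Triple public

ΔTriple : Triple → List G
ΔTriple t =
  (a t -G b t) ∷ (b t -G a t) ∷ (a t -G c t) ∷ (c t -G a t) ∷
  (b t -G c t) ∷ (c t -G b t) ∷ []

ΔFamily : List Triple → List G
ΔFamily = concatMap ΔTriple

multiplicity : G → List G → ℕ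
multiplicity g xs = length (filter (g ≟G_) xs)

-- 𝒯 is a (G, Σ, 3, 1)-difference family: Δ𝒯 = G ∖ ⋃Σ as multisets.
IsDifferenceFamily : Spread-2^15-3^1 → List Triple → Set
IsDifferenceFamily Σ 𝒯 =
  ∀ g → multiplicity g (ΔFamily 𝒯) ≡ (if inUnion Σ g then 0 else 1)
  where open import Data.Bool using (if_then_else_)

{-# OPTIONS --safe #-}
module Submission where

-- G = ℤ₂³ × ℤ₁₂ ≅ ℤ₂³ × ℤ₄ × ℤ₃ has 2-torsion ℤ₂³ × {0, 6} of order 16, so exactly
-- 15 involutions u, and the subgroups {0, u} pairwise meet trivially; its unique
-- subgroup of order 3 is {0, 4, 8} in the last coordinate, and it contains no
-- involution.  Their union has 18 elements, leaving 78 = 13 · 6 differences to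
-- cover, which is done by 13 base triples {0, p, q} found by computer search.
-- Every remaining claim is a finite check over G, settled by evaluation.

open import Defs
open import Data.Bool using (if_then_else_)
open import Data.Fin using (Fin; _≟_)
open import Data.Fin.Properties using (all?)
open import Data.List using (List; []; _∷_; filter; lookup)
open import Data.List.Membership.DecPropositional _≟G_ using (_∈_; _∉_; _∈?_)
open import Data.List.Membership.Propositional.Properties using (∈-allFin; ∈-cartesianProduct⁺)
open import Data.List.Relation.Unary.All as All using (All)
open import Data.List.Relation.Unary.Any using (here; there)
open import Data.Nat using (ℕ) renaming (_≟_ to _≟ℕ_)
open import Data.Nat.DivMod using (_mod_)
open import Data.Product using (Σ-syntax; _×_; _,_)
open import Data.Empty using (⊥-elim)
open import Function.Definitions using (Injective)
open import Relation.Binary.PropositionalEquality using (_≡_; _≢_; refl)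
open import Relation.Nullary using (Dec; isYes; ¬?)
open import Relation.Nullary.Decidable
  using (_×-dec_; _→-dec_; False; from-yes; toWitness; fromWitness; toWitnessFalse)

∈-elemsG : ∀ g → g ∈ elemsG
∈-elemsG (a , b , c , d) =
  ∈-cartesianProduct⁺ (∈-allFin a)
    (∈-cartesianProduct⁺ (∈-allFin b) (∈-cartesianProduct⁺ (∈-allFin c) (∈-allFin d)))

all-elemsG⇒∀ : {P : G → Set} → All P elemsG → ∀ g → P g
all-elemsG⇒∀ all-P g = All.lookup all-P (∈-elemsG g)

el : ℕ → ℕ → ℕ → ℕ → G
el a b c d = (a mod 2 , b mod 2 , c mod 2 , d mod 12)

SubtractionClosed : List G → Set
SubtractionClosed L = All (λ x → All (λ y → x -G y ∈ L) L) L

subtractionClosed? : ∀ L → Dec (SubtractionClosed L)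
subtractionClosed? L = All.all? (λ x → All.all? (λ y → x -G y ∈? L) L) L

IsListSubgroup : List G → Set
IsListSubgroup L = 0G ∈ L × SubtractionClosed L

listSubgroup : (L : List G) → IsListSubgroup L → Subgroup
listSubgroup L (0∈L , closed) = record
  { mem        = λ g → isYes (g ∈? L)
  ; isSubgroup = fromWitness 0∈L , λ x y x∈L y∈L →
      fromWitness (All.lookup (All.lookup closed (toWitness x∈L)) (toWitness y∈L))
  }

listSubgroup-trivialIntersection :
  ∀ {L M} (l : IsListSubgroup L) (m : IsListSubgroup M) →
  (∀ {x} → x ∈ L → x ∈ M → x ≡ 0G) →
  TrivialIntersection (listSubgroup L l) (listSubgroup M m)
listSubgroup-trivialIntersection _ _ meet g g∈L g∈M = meet (toWitness g∈L) (toWitness g∈M)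

pair : G → List G
pair u = 0G ∷ u ∷ []

pair-meet-pair : ∀ {u w x} → u ≢ w → x ∈ pair u → x ∈ pair w → x ≡ 0G
pair-meet-pair _   (here x≡0)          _                   = x≡0
pair-meet-pair _   (there (here _))    (here x≡0)          = x≡0
pair-meet-pair u≢w (there (here refl)) (there (here x≡w)) = ⊥-elim (u≢w x≡w)

pair-meet : ∀ {u M x} → u ∉ M → x ∈ pair u → x ∈ M → x ≡ 0G
pair-meet _   (here x≡0)          _   = x≡0
pair-meet u∉M (there (here refl)) u∈M = ⊥-elim (u∉M u∈M)

involutions : List G
involutions = filter (λ g → ¬? (g ≟G 0G) ×-dec ((g +G g) ≟G 0G)) elemsG

-- Well typed because length involutions evaluates to 15.
involution : Fin 15 → G
involution = lookup involutions

involution-injective : Injective _≡_ _≡_ involution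
involution-injective {i} {j} = injective i j
  where
  injective : ∀ i j → involution i ≡ involution j → i ≡ j
  injective = from-yes (all? λ i → all? λ j → involution i ≟G involution j →-dec i ≟ j)

pair-isListSubgroup : ∀ i → IsListSubgroup (pair (involution i))
pair-isListSubgroup i = here refl , closed i
  where
  closed : ∀ i → SubtractionClosed (pair (involution i))
  closed = from-yes (all? λ i → subtractionClosed? (pair (involution i)))

orderThree : List G
orderThree = 0G ∷ el 0 0 0 4 ∷ el 0 0 0 8 ∷ []

orderThree-isListSubgroup : IsListSubgroup orderThree
orderThree-isListSubgroup = here refl , from-yes (subtractionClosed? orderThree)

involution∉orderThree : ∀ i → involution i ∉ orderThree
involution∉orderThree = from-yes (all? λ i → ¬? (involution i ∈? orderThree))

involutionSubgroup : Fin 15 → Subgroup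
involutionSubgroup i = listSubgroup (pair (involution i)) (pair-isListSubgroup i)

orderThreeSubgroup : Subgroup
orderThreeSubgroup = listSubgroup orderThree orderThree-isListSubgroup

spread : Spread-2^15-3^1
spread = record
  { A      = involutionSubgroup
  ; B      = orderThreeSubgroup
  ; orderA = from-yes (all? λ i → order (involutionSubgroup i) ≟ℕ 2)
  ; orderB = refl
  ; trivAA = λ i j i≢j → listSubgroup-trivialIntersection (pair-isListSubgroup i) (pair-isListSubgroup j)
               (pair-meet-pair λ eq → i≢j (involution-injective eq))
  ; trivAB = λ i → listSubgroup-trivialIntersection (pair-isListSubgroup i) orderThree-isListSubgroup
               (pair-meet (involution∉orderThree i))
  }

triple₀ : (p q : G) → {False (0G ≟G p)} → {False (0G ≟G q)} → {False (p ≟G q)} → Triple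
triple₀ p q {0≢p} {0≢q} {p≢q} =
  triple 0G p q (toWitnessFalse 0≢p) (toWitnessFalse 0≢q) (toWitnessFalse p≢q)

baseTriples : List Triple
baseTriples =
    triple₀ (el 0 0 0 2) (el 0 1 0 4)
  ∷ triple₀ (el 0 0 0 1) (el 1 0 0 5)
  ∷ triple₀ (el 0 0 1 3) (el 1 1 0 11)
  ∷ triple₀ (el 0 1 1 2) (el 1 0 1 9)
  ∷ triple₀ (el 0 0 0 5) (el 1 1 1 2)
  ∷ triple₀ (el 0 0 1 1) (el 1 0 0 9)
  ∷ triple₀ (el 0 0 0 3) (el 0 0 1 7)
  ∷ triple₀ (el 0 1 1 4) (el 1 0 1 7)
  ∷ triple₀ (el 0 1 0 1) (el 1 0 0 11)
  ∷ triple₀ (el 0 0 1 2) (el 0 1 0 3)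
  ∷ triple₀ (el 0 1 0 5) (el 1 0 1 10)
  ∷ triple₀ (el 0 1 1 5) (el 1 0 1 1)
  ∷ triple₀ (el 0 1 1 3) (el 1 0 0 2)
  ∷ []

lemma3p7 : Σ[ S ∈ Spread-2^15-3^1 ] Σ[ 𝒯 ∈ List Triple ] IsDifferenceFamily S 𝒯
lemma3p7 = spread , baseTriples , all-elemsG⇒∀ (from-yes (All.all? multiplicity-correct? elemsG))
  where
  multiplicity-correct? : ∀ g →
    Dec (multiplicity g (ΔFamily baseTriples) ≡ (if inUnion spread g then 0 else 1))
  multiplicity-correct? g =
    multiplicity g (ΔFamily baseTriples) ≟ℕ (if inUnion spread g then 0 else 1)
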